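{- Let $\mathsf{Ag}=\{a,b\}$, $G=\{a,b\}$, and let $\mathcal{G}_3$, $\chi$ and $\rho$ be as described in the context. Let $\mathrm{I}$ be an information perspective in which agent $a$'s strategy is common knowledge among $G$. Then $\mathcal{G}_3,(\chi,\mathrm{I},\rho)\Vdash\mathsf{C}_Gp$.
   Context: Fix a countable set $\mathsf{Prop}$ of atomic propositions containing $p,q$, and the set of agents $\mathsf{Ag}=\{a,b\}$. A concurrent game structure is a tuple $\mathcal{G}=(\mathsf{Ac},\mathsf{V},\mathsf{E},\ell,(\sim_c)_{c\in\mathsf{Ag}})$ where $\mathsf{Ac}$ is a finite set of actions, $\mathsf{V}$ a finite set of positions, $\mathsf{E}:\mathsf{V}\times\mathsf{Ac}^{\mathsf{Ag}}\to\mathsf{V}$ a transition function, $\ell:\mathsf{V}\to\mathcal{P}(\mathsf{Prop})$ a valuation, and each $\sim_c\subseteq(\mathsf{V}\times\mathsf{V})\cup(\mathsf{Ac}\times\mathsf{Ac})$ an equivalence relation. A joint action is a function $\gamma:\mathsf{Ag}\to\mathsf{Ac}$; $\gamma\sim_c\delta$ iff $\gamma(d)\sim_c\delta(d)$ for all $d$. A history is a sequence $\rho=v_0\gamma_1v_1\ldots\gamma_nv_n$ of positions and joint actions with $\mathsf{E}(v_i,\gamma_{i+1})=v_{i+1}$; $\rho_{\le i}=v_0\gamma_1\ldots\gamma_iv_i$, $\mathsf{last}(\rho)=v_n$; $\mathsf{Hist}$ is the set of histories. $\rho\sim_c\rho'$ iff they have the same number $n$ of joint actions, their $i$-th positions are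 $\sim_c$-related ($i\le n$) and their $i$-th joint actions are $\sim_c$-related ($1\le i\le n$). A strategy is a function $\mathsf{Hist}\to\mathsf{Ac}$; an assignment is a function from $\mathsf{Ag}$ to strategies. $\rho$ is consistent with $\chi$ for $X\subseteq\mathsf{Ag}$ if $\gamma_{i+1}(d)=\chi(d)(\rho_{\le i})$ for all $i<n$, $d\in X$. The one-step continuation is $\mathsf{X}^\chi_{\mathcal G}\rho=\rho\,\gamma_{n+1}v_{n+1}$ with $\gamma_{n+1}(d)=\chi(d)(\rho)$ and $v_{n+1}=\mathsf{E}(v_n,\gamma_{n+1})$. $\mathsf{Ag}^*$ is the set of finite words over $\mathsf{Ag}$ with no two equal adjacent letters; $\mathsf{Ag}^{\ge n}$ those of length $\ge n$, and similarly $G^{\ge n}$ for words over $G$; $cw$ denotes $w$ prefixed by $c$. An information perspective is a set $\mathrm{I}\subseteq\mathsf{Ag}^{\ge2}$; $\mathrm{I}_c=\{d: cd\in\mathrm{I}\}\cup\{c\}$; $\mathrm{I}[c]=\{w\in\mathsf{Ag}^{\ge2}: cw\in\mathrm{I}\}\cup\{w\in\mathrm{I}: w=cw'\text{ for some }w'\in\mathsf{Ag}^*\}$. Agent $a$'s strategy is common knowledge among $G$ in $\mathrm{I}$ if $wa\in\mathrm{I}$ for every $w\in G^{\ge1}$ such that $wa$ has no two equal adjacent letters (i.e. $ba,aba,baba,\ldots\in\mathrm{I}$). $\chi\sim^{\mathrm{I}}_c\chi'$ iff $\chi(d)=\chi'(d)$ for all $d\in\mathrm{I}_c$. A state is a triple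 $(\chi,\mathrm{I},\rho)$; it is $c$-consistent if $\rho$ is consistent with $\chi$ for $\mathrm{I}_c$. $(\chi,\mathrm{I},\rho)\trianglelefteq_c(\chi',\mathrm{I}',\rho')$ iff $\chi\sim^{\mathrm{I}}_c\chi'$, $\mathrm{I}[c]\subseteq\mathrm{I}'$, $\rho\sim_c\rho'$, and both states are $c$-consistent. $Z\trianglelefteq_GZ'$ iff $Z\trianglelefteq_cZ'$ for some $c\in G$; $\trianglelefteq^*_G$ is its transitive closure. Truth: $\mathcal{G},(\chi,\mathrm{I},\rho)\Vdash p$ iff $p\in\ell(\mathsf{last}(\rho))$; $\mathcal{G},Z\Vdash\mathsf{C}_G\phi$ iff $\mathcal{G},Z'\Vdash\phi$ for all $Z'$ with $Z\trianglelefteq^*_GZ'$. The structure $\mathcal{G}_3$: positions $v_1,v_2,v_3$; actions $\mathsf{Ac}=\{\alpha,\beta\}$; $\mathsf{E}(v_1,\gamma)=v_2$ if $\gamma(a)=\alpha$ and $=v_3$ if $\gamma(a)=\beta$; $\mathsf{E}(v_2,\gamma)=v_2$, $\mathsf{E}(v_3,\gamma)=v_3$ for all $\gamma$; $\ell(v_1)=\emptyset$, $\ell(v_2)=\{p\}$, $\ell(v_3)=\{q\}$. Agent $a$ distinguishes all positions and both actions ($\sim_a$ is equality); for agent $b$, $v_2\sim_bv_3$ and $\alpha\sim_b\beta$, while $v_1$ is $\sim_b$-related only to itself. $\chi$ is an assignment with $\chi(a)(v_1)=\alpha$ (here $v_1$ is the history of length zero), and $\rho=v_1\gamma_1v_2$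 where $\gamma_1(a)=\alpha$ and $\gamma_1(b)=\chi(b)(v_1)$. -}

module Defs where

import Level
open import Level using (Lift)
open import Data.Nat using (ℕ; _≤_; zero; suc)
open import Data.List using (List; []; _∷_; _++_; length)
open import Data.Product using (_×_; Σ; ∃; _,_)
open import Data.Sum using (_⊎_)
open import Data.Unit using (⊤)
open import Data.Empty using (⊥)
open import Relation.Binary.PropositionalEquality using (_≡_; _≢_)
open import Relation.Binary.Construct.Closure.Transitive using (TransClosure)

data Agent : Set where
  a b : Agent

Prop : Set
Prop = ℕ

p q : Prop
p = 0
q = 1

data Action : Set where
  α β : Action

data Pos : Set where
  v₁ v₂ v₃ : Pos

JointAction : Set
JointAction = Agent → Action

E : Pos → JointAction → Pos
E v₁ γ with γ a
... | α = v₂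
... | β = v₃
E v₂ γ = v₂
E v₃ γ = v₃

ℓ : Pos → Prop → Set
ℓ v₁ x = ⊥
ℓ v₂ x = x ≡ p
ℓ v₃ x = x ≡ q

PosRel : Agent → Pos → Pos → Set
PosRel a v w = v ≡ w
PosRel b v₁ v₁ = ⊤
PosRel b v₁ _  = ⊥
PosRel b _  v₁ = ⊥
PosRel b _  _  = ⊤

ActRel : Agent → Action → Action → Set
ActRel a x y = x ≡ y
ActRel b x y = ⊤

JointRel : Agent → JointAction → JointAction → Set
JointRel c γ δ = ∀ d → ActRel c (γ d) (δ d)

-- Histories: v₀ γ₁ v₁ … γₙ vₙ with vᵢ₊₁ = E(vᵢ, γᵢ₊₁).
-- Since positions after the first are determined by E, a history is
-- an initial position followed by a sequence of joint actions (snoc list).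

data Hist : Set where
  start : Pos → Hist
  _▸_   : Hist → JointAction → Hist

last : Hist → Pos
last (start v) = v
last (h ▸ γ) = E (last h) γ

HistRel : Agent → Hist → Hist → Set
HistRel c (start v) (start w) = PosRel c v w
HistRel c (start v) (h' ▸ γ') = ⊥
HistRel c (h ▸ γ) (start w) = ⊥
HistRel c (h ▸ γ) (h' ▸ γ') =
  HistRel c h h' × JointRel c γ γ' × PosRel c (last (h ▸ γ)) (last (h' ▸ γ'))

Strategy : Set
Strategy = Hist → Action

Assignment : Set
Assignment = Agent → Strategy

Consistent : Assignment → (Agent → Set) → Hist → Set
Consistent χ X (start v) = ⊤
Consistent χ X (h ▸ γ) = Consistent χ X h × (∀ d → X d → γ d ≡ χ d h)

NoAdjRep : List Agent → Set
NoAdjRep [] = ⊤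
NoAdjRep (x ∷ []) = ⊤
NoAdjRep (x ∷ y ∷ r) = x ≢ y × NoAdjRep (y ∷ r)

InAg≥2 : List Agent → Set
InAg≥2 w = NoAdjRep w × 2 ≤ length w

record InfoPersp : Set₁ where
  field
    In : List Agent → Set
    wf : ∀ w → In w → InAg≥2 w
open InfoPersp public

Ic : InfoPersp → Agent → Agent → Set
Ic I c d = In I (c ∷ d ∷ []) ⊎ d ≡ c

I[_] : InfoPersp → Agent → List Agent → Set
I[ I ] c w = (InAg≥2 w × In I (c ∷ w)) ⊎ (In I w × ∃ λ w' → w ≡ c ∷ w')

AllIn : (Agent → Set) → List Agent → Set
AllIn G [] = ⊤
AllIn G (x ∷ w) = G x × AllIn G w

StratCK : Agent → (Agent → Set) → InfoPersp → Set
StratCK c G I =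
  ∀ (w : List Agent) → 1 ≤ length w → AllIn G w → NoAdjRep (w ++ (c ∷ [])) →
  In I (w ++ (c ∷ []))

AssignRel : InfoPersp → Agent → Assignment → Assignment → Set
AssignRel I c χ χ' = ∀ d → Ic I c d → ∀ h → χ d h ≡ χ' d h

record State : Set₁ where
  constructor ⟨_,_,_⟩
  field
    χ : Assignment
    I : InfoPersp
    ρ : Hist

c-Consistent : Agent → State → Set
c-Consistent c Z = Consistent (State.χ Z) (Ic (State.I Z) c) (State.ρ Z)

_⊴⟨_⟩_ : State → Agent → State → Set
Z ⊴⟨ c ⟩ Z' =
  AssignRel (State.I Z) c (State.χ Z) (State.χ Z') ×
  (∀ w → I[ State.I Z ] c w → In (State.I Z') w) ×
  HistRel c (State.ρ Z) (State.ρ Z') ×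
  c-Consistent c Z × c-Consistent c Z'

⊴G : (Agent → Set) → State → State → Set
⊴G G Z Z' = Σ Agent λ c → G c × Z ⊴⟨ c ⟩ Z'

data Formula : Set₁ where
  atom : Prop → Formula
  C    : (Agent → Set) → Formula → Formula

_⊩_ : State → Formula → Set₁
Z ⊩ atom x = Lift (Level.suc Level.zero) (ℓ (last (State.ρ Z)) x)
Z ⊩ C G φ = ∀ Z' → TransClosure (⊴G G) Z Z' → Z' ⊩ φ

Gab : Agent → Set
Gab _ = ⊤

γ₁ : Assignment → JointAction
γ₁ χ a = α
γ₁ χ b = χ b (start v₁)

ρ₃ : Assignment → Hist
ρ₃ χ = start v₁ ▸ γ₁ χ

{-# OPTIONS --safe #-}
module Submission where

-- Along ⊴_G, a's strategy stays common knowledge, since the step agent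
-- c ∈ G passes I[c] on to the new perspective and I[c] contains every word wa
-- required.  So a ∈ I_c on both sides of every step, and c-consistency of both
-- states together with χ(a) = χ'(a) forces the new history to be one joint
-- action long with the same action α for a.  Every reachable history thus
-- ends in v₂, where p holds.

open import Defs
open import Level using (Level; lift)
open import Data.Nat using (z≤n; s≤s)
open import Data.List using ([]; _∷_)
open import Data.Product using (∃; _,_; proj₂)
open import Data.Sum using (inj₁; inj₂)
open import Data.Unit using (tt)
open import Relation.Binary.Definitions using (DecidableEquality)
open import Relation.Binary.PropositionalEquality using (_≡_; refl; sym; ≢-sym; module ≡-Reasoning)
open import Relation.Binary.Construct.Closure.Transitive using (TransClosure; [_]; _∷_)
open import Relation.Nullary using (yes; no)
open import Relation.Unary using (Pred)
open import Relation.Binary.Core using (Rel)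

_≟ᴬ_ : DecidableEquality Agent
a ≟ᴬ a = yes refl
a ≟ᴬ b = no λ ()
b ≟ᴬ a = no λ ()
b ≟ᴬ b = yes refl

StratCK⇒Ic : ∀ {c d G I} → StratCK c G I → G d → Ic I d c
StratCK⇒Ic {c} {d} ck Gd with d ≟ᴬ c
... | yes refl = inj₂ refl
... | no d≢c   = inj₁ (ck (d ∷ []) (s≤s z≤n) (Gd , tt) (d≢c , tt))

StratCK-inherit : ∀ {c d G I I'} → StratCK c G I → G d →
  (∀ w → I[ I ] d w → In I' w) → StratCK c G I'
StratCK-inherit {d = d} {I = I} ck Gd I[d]⊆I' (x ∷ w) l g nr with x ≟ᴬ d
... | yes refl = I[d]⊆I' _ (inj₂ (ck (x ∷ w) l g nr , _ , refl))
... | no x≢d   = I[d]⊆I' _ (inj₁ (wf I _ (ck (x ∷ w) l g nr) ,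
                                  ck (d ∷ x ∷ w) (s≤s z≤n) (Gd , g) (≢-sym x≢d , nr)))

v₁-isolated : ∀ c {v} → PosRel c v₁ v → v ≡ v₁
v₁-isolated a refl = refl
v₁-isolated b {v₁} _ = refl

HistRel-one-step : ∀ {c γ} ρ' → HistRel c (start v₁ ▸ γ) ρ' →
  ∃ λ γ' → ρ' ≡ start v₁ ▸ γ'
HistRel-one-step {c} (start v ▸ γ') (v₁~v , _) rewrite v₁-isolated c v₁~v = γ' , refl
HistRel-one-step ((_ ▸ _) ▸ _) (() , _)

data Afterα : Hist → Set where
  afterα : ∀ γ → γ a ≡ α → Afterα (start v₁ ▸ γ)

Afterα⇒p : ∀ {ρ} → Afterα ρ → ℓ (last ρ) p
Afterα⇒p (afterα γ γa≡α) rewrite γa≡α = refl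

record Invariant (G : Agent → Set) (Z : State) : Set where
  constructor invariant
  field
    strategy-ck : StratCK a G (State.I Z)
    history     : Afterα (State.ρ Z)

Invariant-⊴ : ∀ {G Z Z'} → ⊴G G Z Z' → Invariant G Z → Invariant G Z'
Invariant-⊴ {G} {⟨ χ , I , _ ⟩} {⟨ χ' , I' , ρ' ⟩}
  (c , Gc , χ~χ' , I[c]⊆I' , ρ~ρ' , (_ , consistent) , consistent')
  (invariant ck (afterα γ γa≡α))
  with HistRel-one-step ρ' ρ~ρ'
... | γ' , refl = invariant ck' (afterα γ' γ'a≡α)
  where
  open ≡-Reasoning
  ck' : StratCK a G I'
  ck' = StratCK-inherit {a} {c} {G} {I} {I'} ck Gc I[c]⊆I'
  a∈I-c : Ic I c a
  a∈I-c = StratCK⇒Ic {I = I} ck Gc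
  a∈I'-c : Ic I' c a
  a∈I'-c = StratCK⇒Ic {I = I'} ck' Gc
  γ'a≡α : γ' a ≡ α
  γ'a≡α = begin
    γ' a               ≡⟨ proj₂ consistent' a a∈I'-c ⟩
    χ' a (start v₁)    ≡⟨ sym (χ~χ' a a∈I-c (start v₁)) ⟩
    χ a (start v₁)     ≡⟨ sym (consistent a a∈I-c) ⟩
    γ a                ≡⟨ γa≡α ⟩
    α                  ∎

preserved⁺ : ∀ {ℓa ℓr ℓp : Level} {A : Set ℓa} {R : Rel A ℓr} (P : Pred A ℓp) →
  (∀ {x y} → R x y → P x → P y) → ∀ {x y} → TransClosure R x y → P x → P y
preserved⁺ P step [ r ]    Px = step r Px
preserved⁺ P step (r ∷ rs) Px = preserved⁺ P step rs (step r Px)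

Afterα⇒⊩C-p : ∀ {G χ I ρ} → StratCK a G I → Afterα ρ → ⟨ χ , I , ρ ⟩ ⊩ C G (atom p)
Afterα⇒⊩C-p ck ρ-afterα Z' Z⊴⁺Z' =
  lift (Afterα⇒p (Invariant.history
    (preserved⁺ (Invariant _) Invariant-⊴ Z⊴⁺Z' (invariant ck ρ-afterα))))

theorem2 : (χ : Assignment) → χ a (start v₁) ≡ α →
    (I : InfoPersp) → StratCK a Gab I →
    ⟨ χ , I , ρ₃ χ ⟩ ⊩ C Gab (atom p)
theorem2 χ _ I ck = Afterα⇒⊩C-p ck (afterα (γ₁ χ) refl)
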